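{- Let $p>0$, $\gamma>0$, $n\ge 4p$, and let $\alpha$ satisfy $2p-1\le\alpha\le n-2p-1$ and $\gcd(\alpha,n)=1$. Let $I=\{0,\dots,p-1\}$, $J=\{0,\dots,p-2\}$, let $f_I:I\to I$ and $f_J:J\to J$ be bijections and let $A'$ be the array defined below. Then for every row $a$, $$-(4p+\gamma)n<\Sigma_{A'}(2p)=d_{2p}(r_a)+p<-(4p+\gamma-2)n+p-1,\qquad \Sigma_{A'}(4p-2)=d_{2p}(r_a)+1,$$ and for every column $a\neq 0$, $$-(4p+\gamma)n-p\le\overline{\Sigma}_{A'}(2p)=d_{2p}(c_a)-p\le-(4p+\gamma-2)n-p-2.$$
   Context: Rows and columns of an $n\times n$ array are indexed by $[n]=\{0,\dots,n-1\}$, with row and column indices always taken modulo $n$ (entries are integers, not reduced). The diagonal $D_d$ is $\{(i+d,i): i\in[n]\}$. $A'$ is the $n\times n$ array in which, for all $i\in I$, $j\in J$, $x\in[n]$, the following entries are placed (all other cells empty): $(\gamma+2)n+4f_I(i)n-2x$ in cell $(2i-x,-x)\in D_{2i}$; $-\gamma n-4f_I(i)n-1-2x$ in cell $(2i+1+x,x)\in D_{2i+1}$; $-(4p+\gamma)n+2x$ in cell $(2p-\alpha x,-\alpha x)\in D_{2p}$; $(4p+\gamma-6)n-4f_J(j)n+1+2x$ in cell $(2p+1+2j-x,-x)\in D_{2p+1+2j}$; $-(4p+\gamma-4)n+4f_J(j)n+2x$ in cell $(2p+2+2j+x,x)\in D_{2p+2+2j}$; $(4p+\gamma-2)n+1+2x$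 in cell $(2p+\alpha+\alpha x,\alpha x)\in D_{2p+\alpha}$. For a row $a$, $d_t(r_a)$ is the entry of row $a$ on diagonal $D_t$ ($0$ if none) and $\Sigma_{A'}(y)=\sum_{t=0}^{y}d_t(r_a)$; for a column $a$, $d_t(c_a)$ is the entry of column $a$ on $D_t$ ($0$ if none) and $\overline{\Sigma}_{A'}(y)=\sum_{t=0}^{y}d_t(c_a)$. -}

module Defs where

open import Data.Nat as ℕ using (ℕ; zero; suc)
open import Data.Integer as ℤ using (ℤ; +_; _+_; _-_; _*_; -_)
open import Data.Integer.DivMod using (_%ℕ_)
open import Data.Fin using (Fin; toℕ)
open import Data.Fin.Permutation using (Permutation′; _⟨$⟩ʳ_)
open import Data.List using (List; []; _∷_; _++_; concatMap; upTo; allFin; foldr; map)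
open import Data.Product using (_×_; _,_)
open import Data.Bool using (_∧_; if_then_else_)
open import Relation.Nullary.Decidable using (⌊_⌋)

-- reduction of an integer index modulo n (indices live in [n] = {0,…,n-1});
-- the n = 0 case is never used (n ≥ 4p > 0).
modN : ℕ → ℤ → ℕ
modN zero    z = 0
modN (suc k) z = z %ℕ suc k

-- a placed entry: (row, column, value), row/column already reduced mod n
Placement : Set
Placement = ℕ × ℕ × ℤ

placements : (p γ n α : ℕ) → Permutation′ p → Permutation′ (p ℕ.∸ 1) → List Placement
placements p γ n α fI fJ = concatMap perX (upTo n)
  where
  N G P A : ℤ
  N = + n
  G = + γ
  P = + p
  A = + α
  cell : ℤ → ℤ → ℤ → Placement
  cell r c v = modN n r , modN n c , v
  perX : ℕ → List Placement
  perX x = concatMap perI (allFin p)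
        ++ (cell (+ 2 * P - A * X) (- (A * X)) (- ((+ 4 * P + G) * N) + + 2 * X)
        ∷ concatMap perJ (allFin (p ℕ.∸ 1))
        ++ (cell (+ 2 * P + A + A * X) (A * X) ((+ 4 * P + G - + 2) * N + + 1 + + 2 * X) ∷ []))
    where
    X : ℤ
    X = + x
    perI : Fin p → List Placement
    perI i = cell (+ 2 * I - X) (- X) ((G + + 2) * N + + 4 * F * N - + 2 * X)
           ∷ cell (+ 2 * I + + 1 + X) X (- (G * N) - + 4 * F * N - + 1 - + 2 * X)
           ∷ []
      where
      I F : ℤ
      I = + toℕ i
      F = + toℕ (fI ⟨$⟩ʳ i)
    perJ : Fin (p ℕ.∸ 1) → List Placement
    perJ j = cell (+ 2 * P + + 1 + + 2 * J - X) (- X) ((+ 4 * P + G - + 6) * N - + 4 * F * N + + 1 + + 2 * X)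
           ∷ cell (+ 2 * P + + 2 + + 2 * J + X) X (- ((+ 4 * P + G - + 4) * N) + + 4 * F * N + + 2 * X)
           ∷ []
      where
      J F : ℤ
      J = + toℕ j
      F = + toℕ (fJ ⟨$⟩ʳ j)

lookupCell : List Placement → ℕ → ℕ → ℤ
lookupCell []                r c = + 0
lookupCell ((r′ , c′ , v) ∷ ps) r c =
  if ⌊ r ℕ.≟ r′ ⌋ ∧ ⌊ c ℕ.≟ c′ ⌋ then v else lookupCell ps r c

A′ : (p γ n α : ℕ) → Permutation′ p → Permutation′ (p ℕ.∸ 1) → ℕ → ℕ → ℤ
A′ p γ n α fI fJ = lookupCell (placements p γ n α fI fJ)

sumℤ : List ℤ → ℤ
sumℤ = foldr _+_ (+ 0)

-- d_t(r_a): entry of row a on diagonal D_t, i.e. in cell (a, a - t)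
dRow : ℕ → (ℕ → ℕ → ℤ) → ℕ → ℕ → ℤ
dRow n M a t = M a (modN n (+ a - + t))

-- d_t(c_a): entry of column a on diagonal D_t, i.e. in cell (a + t, a)
dCol : ℕ → (ℕ → ℕ → ℤ) → ℕ → ℕ → ℤ
dCol n M a t = M (modN n (+ a + + t)) a

ΣRow : ℕ → (ℕ → ℕ → ℤ) → ℕ → ℕ → ℤ
ΣRow n M a y = sumℤ (map (dRow n M a) (upTo (suc y)))

ΣCol : ℕ → (ℕ → ℕ → ℤ) → ℕ → ℕ → ℤ
ΣCol n M a y = sumℤ (map (dCol n M a) (upTo (suc y)))

-- Every filled cell of A′ lies on one of the diagonals D_{2i}, D_{2i+1} (i ∈ I), D_{2p},
-- D_{2p+1+2j}, D_{2p+2+2j} (j ∈ J), D_{2p+α}, and since 2p - 1 ≤ α ≤ n - 2p - 1 their offsets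
-- are distinct and below n.  So a row or a column meets each of them in one cell, and that
-- cell is filled because the column ±x or ±αx of the x-th entry runs over all residues
-- (gcd(α, n) = 1).  In row a the entries met on D_{2i} and D_{2i+1} have indices x, y with
-- x + y + 1 = n, so they add up to 1; on D_{2p+1+2j}, D_{2p+2+2j} they add up to -1, and so do
-- the entries of column a ≠ 0 on D_{2i}, D_{2i+1} (there x + y = n).  Hence the partial sums
-- telescope to d_{2p} ± p and d_{2p} + 1, and the bounds follow from d_{2p} = -(4p+γ)n + 2x
-- with 0 ≤ x < n.

module Submission where

open import Defs
open import Data.Nat as ℕ using (ℕ; zero; suc; _∸_; _<_; _≤_; z<s; NonZero)
import Data.Nat.Properties as ℕₚ
open import Data.Nat.DivMod using (m<n⇒m%n≡m; [m+kn]%n≡m%n)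
open import Data.Nat.GCD using (gcd; module Bézout)
open import Data.Nat.Coprimality using (gcd≡1⇒coprime; coprime-Bézout)
open import Data.Integer as ℤ using (ℤ; +_; -[1+_]; _+_; _-_; _*_; -_)
import Data.Integer.Properties as ℤₚ
open import Data.Integer.DivMod using (_/ℕ_; n%ℕd<d; a≡a%ℕn+[a/ℕn]*n)
open import Data.Integer.Tactic.RingSolver using (solve)
open import Data.Nat.Tactic.RingSolver using () renaming (solve-∀ to ℕ-solve-∀)
open import Data.List using (List; []; _∷_; _++_; map; concatMap; upTo; allFin; applyUpTo)
open import Data.List.Properties using (map-applyUpTo)
open import Data.List.Membership.Propositional using (_∈_; find)
open import Data.List.Membership.Propositional.Properties
  using (∈-concatMap⁺; ∈-concatMap⁻; ∈-++⁺ˡ; ∈-++⁺ʳ; ∈-++⁻; ∈-upTo⁺; ∈-upTo⁻; ∈-allFin)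
open import Data.List.Relation.Unary.Any as Any using (here; there)
open import Data.Product using (∃-syntax; _×_; _,_; proj₁; proj₂)
open import Data.Sum using (inj₁; inj₂)
open import Data.Fin using (Fin; toℕ; fromℕ<)
open import Data.Fin.Patterns using (0F; 1F)
import Data.Fin.Properties as Finₚ
open import Data.Fin.Permutation using (Permutation′; _⟨$⟩ʳ_)
open import Data.Empty using (⊥-elim)
open import Function using (_∘_; id)
open import Relation.Nullary using (yes; no)
open import Relation.Binary.PropositionalEquality
  using (_≡_; _≢_; refl; sym; trans; cong; cong₂; subst; module ≡-Reasoning)
open ≡-Reasoning

infix 4 _≡_mod_
record _≡_mod_ (a b m : ℤ) : Set where
  constructor congruent
  field
    quotient : ℤ
    equality : a ≡ b + quotient * m

module _ {m : ℤ} where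

  ≡⇒≡-mod : ∀ {a b} → a ≡ b → a ≡ b mod m
  ≡⇒≡-mod {a} refl = congruent (+ 0) (solve (a ∷ m ∷ []))

  ≡-mod-sym : ∀ {a b} → a ≡ b mod m → b ≡ a mod m
  ≡-mod-sym {a} {b} (congruent k eq) = congruent (- k) (begin
    b                   ≡⟨ solve (b ∷ k ∷ m ∷ []) ⟩
    b + k * m + - k * m ≡⟨ cong (_+ - k * m) eq ⟨
    a + - k * m         ∎)

  ≡-mod-trans : ∀ {a b c} → a ≡ b mod m → b ≡ c mod m → a ≡ c mod m
  ≡-mod-trans {c = c} (congruent k refl) (congruent l refl) = congruent (l + k) (solve (c ∷ k ∷ l ∷ m ∷ []))

  ≡-mod-+ʳ : ∀ {a b} c → a ≡ b mod m → a + c ≡ b + c mod m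
  ≡-mod-+ʳ {b = b} c (congruent k refl) = congruent k (solve (b ∷ c ∷ k ∷ m ∷ []))

  ≡-mod-*ˡ : ∀ {a b} c → a ≡ b mod m → c * a ≡ c * b mod m
  ≡-mod-*ˡ {b = b} c (congruent k refl) = congruent (c * k) (solve (b ∷ c ∷ k ∷ m ∷ []))

  ≡-mod-+-cancelˡ : ∀ {a a′ b b′} → a ≡ a′ mod m → a + b ≡ a′ + b′ mod m → b ≡ b′ mod m
  ≡-mod-+-cancelˡ {a′ = a′} {b} {b′} (congruent k refl) (congruent l eq) = congruent (l - k) (begin
    b                        ≡⟨ solve (a′ ∷ b ∷ k ∷ m ∷ []) ⟩
    (a′ + k * m + b) - (a′ + k * m) ≡⟨ cong (_- (a′ + k * m)) eq ⟩
    (a′ + b′ + l * m) - (a′ + k * m) ≡⟨ solve (a′ ∷ b′ ∷ k ∷ l ∷ m ∷ []) ⟩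
    b′ + (l - k) * m        ∎)

  ≡-mod-*-cancelʳ : ∀ {u v} c → u * v ≡ + 1 mod m → u * (v * c) ≡ c mod m
  ≡-mod-*-cancelʳ {u} {v} c (congruent k eq) = congruent (k * c) (begin
    u * (v * c)     ≡⟨ solve (u ∷ v ∷ c ∷ []) ⟩
    (u * v) * c     ≡⟨ cong (_* c) eq ⟩
    (+ 1 + k * m) * c ≡⟨ solve (c ∷ k ∷ m ∷ []) ⟩
    c + k * c * m   ∎)

modN-< : ∀ {n} .{{_ : NonZero n}} z → modN n z < n
modN-< {suc n} z = n%ℕd<d z (suc n)

≡-modN : ∀ {n} .{{_ : NonZero n}} z → z ≡ + modN n z mod + n
≡-modN {suc n} z = congruent (z /ℕ suc n) (a≡a%ℕn+[a/ℕn]*n z (suc n))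

residue-unique : ∀ {n r s} k → r < n → s < n → r ≡ s ℕ.+ k ℕ.* n → r ≡ s
residue-unique {suc n} {s = s} k r<n s<n refl = begin
  s ℕ.+ k ℕ.* suc n               ≡⟨ m<n⇒m%n≡m r<n ⟨
  (s ℕ.+ k ℕ.* suc n) ℕ.% suc n   ≡⟨ [m+kn]%n≡m%n s k (suc n) ⟩
  s ℕ.% suc n                     ≡⟨ m<n⇒m%n≡m s<n ⟩
  s                               ∎

≡-mod⇒≡ : ∀ {n r s} → r < n → s < n → + r ≡ + s mod + n → r ≡ s
≡-mod⇒≡ {n} {r} {s} r<n s<n (congruent (+ k) eq) =
  residue-unique k r<n s<n (ℤₚ.+-injective (trans eq (cong (_+_ (+ s)) (sym (ℤₚ.pos-* k n)))))
≡-mod⇒≡ {n} {r} {s} r<n s<n (congruent -[1+ k ] eq) =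
  sym (residue-unique (suc k) s<n r<n
         (ℤₚ.+-injective (trans eq′ (cong (_+_ (+ r)) (sym (ℤₚ.pos-* (suc k) n))))))
  where
  eq′ : + s ≡ + r + + suc k * + n
  eq′ = _≡_mod_.equality (≡-mod-sym {+ n} (congruent -[1+ k ] eq))

≡-mod⇒modN≡ : ∀ {n r} z → r < n → z ≡ + r mod + n → modN n z ≡ r
≡-mod⇒modN≡ {n} z r<n z≡r = ≡-mod⇒≡ (modN-< z) r<n (≡-mod-trans (≡-mod-sym (≡-modN z)) z≡r)
  where instance _ = ℕ.>-nonZero (ℕₚ.m<n⇒0<n r<n)

modN≡⇒≡-mod : ∀ {n r} .{{_ : NonZero n}} z → modN n z ≡ r → z ≡ + r mod + n
modN≡⇒≡-mod {n} z refl = ≡-modN z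

n≡x+[n∸1+x]+1 : ∀ {n x} → x < n → + n ≡ + x + + (n ∸ suc x) + + 1
n≡x+[n∸1+x]+1 {n} {x} x<n = cong +_ (sym (trans (ℕₚ.+-comm (x ℕ.+ (n ∸ suc x)) 1) (ℕₚ.m+[n∸m]≡n x<n)))

y≡-x-1⇒n≡x+y+1 : ∀ {n x y} → x < n → y < n → + y ≡ - + x - + 1 mod + n → + n ≡ + x + + y + + 1
y≡-x-1⇒n≡x+y+1 {n} {x} {y} x<n y<n (congruent k eq) =
  subst (λ w → + n ≡ + x + + w + + 1) (sym y≡z) (n≡x+[n∸1+x]+1 x<n)
  where
  z : ℕ
  z = n ∸ suc x
  shift : ∀ N X Y Z k → N ≡ X + Z + + 1 → Y ≡ - X - + 1 + k * N → Y ≡ Z + (k - + 1) * N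
  shift _ X _ Z k refl refl = solve (X ∷ Z ∷ k ∷ [])
  y≡z : y ≡ z
  y≡z = ≡-mod⇒≡ y<n (ℕₚ.∸-monoʳ-< z<s x<n)
          (congruent (k - + 1) (shift (+ n) (+ x) (+ y) (+ z) k (n≡x+[n∸1+x]+1 x<n) eq))

invertible⇒surjective : ∀ {n} .{{_ : NonZero n}} u {v} → u * v ≡ + 1 mod + n
                      → ∀ c → ∃[ x ] x < n × u * + x ≡ c mod + n
invertible⇒surjective {n} u {v} uv≡1 c =
  modN n (v * c) , modN-< (v * c) ,
  ≡-mod-trans (≡-mod-*ˡ u (≡-mod-sym (≡-modN (v * c)))) (≡-mod-*-cancelʳ {u = u} c uv≡1)

gcd≡1⇒invertible : ∀ {α n} → gcd α n ≡ 1 → ∃[ v ] + α * v ≡ + 1 mod + n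
gcd≡1⇒invertible {α} {n} gcd≡1 with coprime-Bézout (gcd≡1⇒coprime gcd≡1)
... | Bézout.+- x y eq = + x , congruent (+ y) (begin
  + α * + x         ≡⟨ ℤₚ.pos-* α x ⟨
  + (α ℕ.* x)       ≡⟨ cong +_ (trans (ℕₚ.*-comm α x) (sym eq)) ⟩
  + (1 ℕ.+ y ℕ.* n) ≡⟨ cong (_+_ (+ 1)) (ℤₚ.pos-* y n) ⟩
  + 1 + + y * + n   ∎)
... | Bézout.-+ x y eq = - + x , congruent (- + y) (begin
  + α * - + x             ≡⟨ negate (+ α) (+ x) ⟩
  + 1 - (+ 1 + + α * + x) ≡⟨ cong (λ w → + 1 - (+ 1 + w)) (ℤₚ.pos-* α x) ⟨
  + 1 - + (1 ℕ.+ α ℕ.* x) ≡⟨ cong (λ w → + 1 - + (1 ℕ.+ w)) (ℕₚ.*-comm α x) ⟩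
  + 1 - + (1 ℕ.+ x ℕ.* α) ≡⟨ cong (λ w → + 1 - + w) eq ⟩
  + 1 - + (y ℕ.* n)       ≡⟨ cong (λ w → + 1 - w) (ℤₚ.pos-* y n) ⟩
  + 1 - + y * + n         ≡⟨ cong (_+_ (+ 1)) (ℤₚ.neg-distribˡ-* (+ y) (+ n)) ⟩
  + 1 + - + y * + n       ∎)
  where
  negate : ∀ A X → A * - X ≡ + 1 - (+ 1 + A * X)
  negate A X = solve (A ∷ X ∷ [])

lookupCell-∈ : ∀ {P : ℤ → Set} ps {r c v} → (r , c , v) ∈ ps
             → (∀ {w} → (r , c , w) ∈ ps → P w) → P (lookupCell ps r c)
lookupCell-∈ ((r′ , c′ , v′) ∷ ps) {r} {c} v∈ P-all with r ℕ.≟ r′ | c ℕ.≟ c′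
... | yes refl | yes refl = P-all (here refl)
... | yes _    | no c≢c′  = lookupCell-∈ ps (Any.tail (c≢c′ ∘ cong (proj₁ ∘ proj₂)) v∈) (P-all ∘ there)
... | no r≢r′  | _        = lookupCell-∈ ps (Any.tail (r≢r′ ∘ cong proj₁) v∈) (P-all ∘ there)

sumℤ-applyUpTo-suc : ∀ (f : ℕ → ℤ) m → sumℤ (applyUpTo f (suc m)) ≡ sumℤ (applyUpTo f m) + f m
sumℤ-applyUpTo-suc f zero    = ℤₚ.+-comm (f 0) (+ 0)
sumℤ-applyUpTo-suc f (suc m) = trans (cong (_+_ (f 0)) (sumℤ-applyUpTo-suc (f ∘ suc) m)) (sym (ℤₚ.+-assoc (f 0) _ _))

sumℤ-upTo-suc : ∀ (f : ℕ → ℤ) m → sumℤ (map f (upTo (suc m))) ≡ sumℤ (map f (upTo m)) + f m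
sumℤ-upTo-suc f m = begin
  sumℤ (map f (upTo (suc m)))     ≡⟨ cong sumℤ (map-applyUpTo id f (suc m)) ⟩
  sumℤ (applyUpTo f (suc m))      ≡⟨ sumℤ-applyUpTo-suc f m ⟩
  sumℤ (applyUpTo f m) + f m      ≡⟨ cong (λ l → sumℤ l + f m) (map-applyUpTo id f m) ⟨
  sumℤ (map f (upTo m)) + f m     ∎

sumℤ-upTo-pairs : ∀ (f : ℕ → ℤ) m k c → (∀ j → j < k → f (m ℕ.+ 2 ℕ.* j) + f (suc (m ℕ.+ 2 ℕ.* j)) ≡ c)
                → sumℤ (map f (upTo (m ℕ.+ 2 ℕ.* k))) ≡ sumℤ (map f (upTo m)) + + k * c
sumℤ-upTo-pairs f m zero    c pair = trans (cong (λ l → sumℤ (map f (upTo l))) (ℕₚ.+-identityʳ m)) (sym (ℤₚ.+-identityʳ _))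
sumℤ-upTo-pairs f m (suc k) c pair = begin
  Σf (m ℕ.+ 2 ℕ.* suc k)      ≡⟨ cong Σf m+2[1+k]≡2+t ⟩
  Σf (suc (suc t))            ≡⟨ sumℤ-upTo-suc f (suc t) ⟩
  Σf (suc t) + f (suc t)      ≡⟨ cong (_+ f (suc t)) (sumℤ-upTo-suc f t) ⟩
  Σf t + f t + f (suc t)      ≡⟨ ℤₚ.+-assoc (Σf t) (f t) (f (suc t)) ⟩
  Σf t + (f t + f (suc t))    ≡⟨ cong₂ _+_ (sumℤ-upTo-pairs f m k c (λ j → pair j ∘ ℕₚ.m<n⇒m<1+n)) (pair k ℕₚ.≤-refl) ⟩
  Σf m + + k * c + c          ≡⟨ add-one (Σf m) (+ k) c ⟩
  Σf m + + suc k * c          ∎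
  where
  Σf : ℕ → ℤ
  Σf l = sumℤ (map f (upTo l))
  t : ℕ
  t = m ℕ.+ 2 ℕ.* k
  m+2[1+k]≡2+t : m ℕ.+ 2 ℕ.* suc k ≡ suc (suc t)
  m+2[1+k]≡2+t = trans (cong (m ℕ.+_) (ℕₚ.*-suc 2 k)) (trans (ℕₚ.+-suc m _) (cong suc (ℕₚ.+-suc m _)))
  add-one : ∀ S K c → S + K * c + c ≡ S + (+ 1 + K) * c
  add-one S K c = solve (S ∷ K ∷ c ∷ [])

<-by : ∀ {a b} k → b ≡ a + + suc k → a ℤ.< b
<-by {a} k refl = subst (ℤ._< a + + suc k) (ℤₚ.+-identityʳ a) (ℤₚ.+-monoʳ-< a (ℤ.+<+ z<s))

≤-by : ∀ {a b} k → b ≡ a + + k → a ℤ.≤ b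
≤-by {a} k refl = ℤₚ.i≤i+j a (+ k)

∀Fin⇒∀< : ∀ {k} {P : ℕ → Set} → (∀ (i : Fin k) → P (toℕ i)) → ∀ m → m < k → P m
∀Fin⇒∀< {P = P} P-Fin m m<k = subst P (Finₚ.toℕ-fromℕ< m<k) (P-Fin (fromℕ< m<k))

digit+double-injective : ∀ (b b′ : Fin 2) {m m′}
                       → toℕ b ℕ.+ 2 ℕ.* m ≡ toℕ b′ ℕ.+ 2 ℕ.* m′ → b ≡ b′ × m ≡ m′
digit+double-injective 0F 0F {m} {m′} eq = refl , ℕₚ.*-cancelˡ-≡ m m′ 2 eq
digit+double-injective 0F 1F {m} {m′} eq = ⊥-elim (ℕₚ.even≢odd m m′ eq)
digit+double-injective 1F 0F {m} {m′} eq = ⊥-elim (ℕₚ.even≢odd m′ m (sym eq))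
digit+double-injective 1F 1F {m} {m′} eq = refl , ℕₚ.*-cancelˡ-≡ m m′ 2 (ℕₚ.suc-injective eq)

digit+double-< : ∀ (b : Fin 2) {m k} → m < k → toℕ b ℕ.+ 2 ℕ.* m < 2 ℕ.* k
digit+double-< b {m} {k} m<k =
  ℕₚ.<-≤-trans (ℕₚ.+-monoˡ-< (2 ℕ.* m) (Finₚ.toℕ<n b))
               (subst (ℕ._≤ 2 ℕ.* k) (ℕₚ.*-suc 2 m) (ℕₚ.*-monoʳ-≤ 2 m<k))

module Array (q γ n α : ℕ) (fI : Permutation′ (suc q)) (fJ : Permutation′ q) where

  p : ℕ
  p = suc q

  N P G : ℤ
  N = + n
  P = + p
  G = + γ

  FI : Fin p → ℤ
  FI i = + toℕ (fI ⟨$⟩ʳ i)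

  FJ : Fin q → ℤ
  FJ j = + toℕ (fJ ⟨$⟩ʳ j)

  data Block : Set where
    I : Fin p → Block
    J : Fin q → Block

  -- pair (I i) b is D_{2i+b} and pair (J j) b is D_{2p+1+2j+b}.
  data Diagonal : Set where
    pair : Block → Fin 2 → Diagonal
    D₂ₚ D₂ₚ₊α : Diagonal

  base : Block → ℕ
  base (I i) = 2 ℕ.* toℕ i
  base (J j) = suc (2 ℕ.* p) ℕ.+ 2 ℕ.* toℕ j

  offset : Diagonal → ℕ
  offset (pair β b) = toℕ b ℕ.+ base β
  offset D₂ₚ       = 2 ℕ.* p
  offset D₂ₚ₊α     = 2 ℕ.* p ℕ.+ α

  row column value : Diagonal → ℕ → ℤ
  row (pair (I i) 0F) x = + 2 * + toℕ i - + x
  row (pair (I i) 1F) x = + 2 * + toℕ i + + 1 + + x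
  row (pair (J j) 0F) x = + 2 * P + + 1 + + 2 * + toℕ j - + x
  row (pair (J j) 1F) x = + 2 * P + + 2 + + 2 * + toℕ j + + x
  row D₂ₚ x             = + 2 * P - + α * + x
  row D₂ₚ₊α x           = + 2 * P + + α + + α * + x

  column (pair _ 0F) x = - + x
  column (pair _ 1F) x = + x
  column D₂ₚ x         = - (+ α * + x)
  column D₂ₚ₊α x       = + α * + x

  value (pair (I i) 0F) x = (G + + 2) * N + + 4 * FI i * N - + 2 * + x
  value (pair (I i) 1F) x = - (G * N) - + 4 * FI i * N - + 1 - + 2 * + x
  value (pair (J j) 0F) x = (+ 4 * P + G - + 6) * N - + 4 * FJ j * N + + 1 + + 2 * + x
  value (pair (J j) 1F) x = - ((+ 4 * P + G - + 4) * N) + + 4 * FJ j * N + + 2 * + x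
  value D₂ₚ x             = - ((+ 4 * P + G) * N) + + 2 * + x
  value D₂ₚ₊α x           = (+ 4 * P + G - + 2) * N + + 1 + + 2 * + x

  entry : Diagonal → ℕ → Placement
  entry φ x = modN n (row φ x) , modN n (column φ x) , value φ x

  pairEntries : ∀ {k} → (Fin k → Block) → ℕ → Fin k → List Placement
  pairEntries B x i = entry (pair (B i) 0F) x ∷ entry (pair (B i) 1F) x ∷ []

  blockEntries : ∀ {k} → (Fin k → Block) → ℕ → List Placement
  blockEntries {k} B x = concatMap (pairEntries B x) (allFin k)

  entriesAt : ℕ → List Placement
  entriesAt x = blockEntries I x ++ entry D₂ₚ x ∷ blockEntries J x ++ entry D₂ₚ₊α x ∷ []

  entries : List Placement
  entries = concatMap entriesAt (upTo n)

  -- A is definitionally lookupCell entries: entriesAt unfolds to the body of placements.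
  A : ℕ → ℕ → ℤ
  A = A′ p γ n α fI fJ

  entry-∈ : ∀ φ {x} → x < n → entry φ x ∈ entries
  entry-∈ φ {x} x<n = ∈-concatMap⁺ entriesAt (Any.map (λ { refl → ∈-entriesAt φ }) (∈-upTo⁺ x<n))
    where
    ∈-blockEntries : ∀ {k} (B : Fin k → Block) i b → entry (pair (B i) b) x ∈ blockEntries B x
    ∈-blockEntries B i b = ∈-concatMap⁺ (pairEntries B x) (Any.map (λ { refl → ∈-pairEntries b }) (∈-allFin i))
      where
      ∈-pairEntries : ∀ b → entry (pair (B i) b) x ∈ pairEntries B x i
      ∈-pairEntries 0F = here refl
      ∈-pairEntries 1F = there (here refl)
    ∈-entriesAt : ∀ φ → entry φ x ∈ entriesAt x
    ∈-entriesAt (pair (I i) b) = ∈-++⁺ˡ (∈-blockEntries I i b)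
    ∈-entriesAt D₂ₚ            = ∈-++⁺ʳ (blockEntries I x) (here refl)
    ∈-entriesAt (pair (J j) b) = ∈-++⁺ʳ (blockEntries I x) (there (∈-++⁺ˡ (∈-blockEntries J j b)))
    ∈-entriesAt D₂ₚ₊α          = ∈-++⁺ʳ (blockEntries I x) (there (∈-++⁺ʳ (blockEntries J x) (here refl)))

  ∈-entries⁻ : ∀ {e} → e ∈ entries → ∃[ φ ] ∃[ x ] x < n × e ≡ entry φ x
  ∈-entries⁻ e∈ with find (∈-concatMap⁻ entriesAt {xs = upTo n} e∈)
  ... | x , x∈ , e∈At = let φ , e≡ = ∈-entriesAt⁻ e∈At in φ , x , ∈-upTo⁻ x∈ , e≡
    where
    ∈-blockEntries⁻ : ∀ {k e x} (B : Fin k → Block) → e ∈ blockEntries B x → ∃[ φ ] e ≡ entry φ x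
    ∈-blockEntries⁻ {k} {x = x} B e∈ with find (∈-concatMap⁻ (pairEntries B x) {xs = allFin k} e∈)
    ... | i , _ , here e≡         = pair (B i) 0F , e≡
    ... | i , _ , there (here e≡) = pair (B i) 1F , e≡
    ∈-entriesAt⁻ : ∀ {e x} → e ∈ entriesAt x → ∃[ φ ] e ≡ entry φ x
    ∈-entriesAt⁻ {x = x} e∈ with ∈-++⁻ (blockEntries I x) e∈
    ... | inj₁ e∈I            = ∈-blockEntries⁻ I e∈I
    ... | inj₂ (here e≡)      = D₂ₚ , e≡
    ... | inj₂ (there e∈′) with ∈-++⁻ (blockEntries J x) e∈′
    ...   | inj₁ e∈J          = ∈-blockEntries⁻ J e∈J
    ...   | inj₂ (here e≡)    = D₂ₚ₊α , e≡

  row≡column+offset : ∀ φ x → row φ x ≡ column φ x + + offset φ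
  row≡column+offset (pair (I i) 0F) x =
    trans (shift (+ toℕ i) (+ x)) (cong (_+_ (- + x)) (sym (ℤₚ.pos-* 2 (toℕ i))))
    where shift : ∀ K X → + 2 * K - X ≡ - X + + 2 * K
          shift K X = solve (K ∷ X ∷ [])
  row≡column+offset (pair (I i) 1F) x =
    trans (shift (+ toℕ i) (+ x)) (cong (λ w → + x + (+ 1 + w)) (sym (ℤₚ.pos-* 2 (toℕ i))))
    where shift : ∀ K X → + 2 * K + + 1 + X ≡ X + (+ 1 + + 2 * K)
          shift K X = solve (K ∷ X ∷ [])
  row≡column+offset (pair (J j) 0F) x =
    trans (shift P (+ toℕ j) (+ x))
          (cong₂ (λ u w → - + x + (+ 1 + u + w)) (sym (ℤₚ.pos-* 2 p)) (sym (ℤₚ.pos-* 2 (toℕ j))))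
    where shift : ∀ P K X → + 2 * P + + 1 + + 2 * K - X ≡ - X + (+ 1 + + 2 * P + + 2 * K)
          shift P K X = solve (P ∷ K ∷ X ∷ [])
  row≡column+offset (pair (J j) 1F) x =
    trans (shift P (+ toℕ j) (+ x))
          (cong₂ (λ u w → + x + (+ 1 + (+ 1 + u + w))) (sym (ℤₚ.pos-* 2 p)) (sym (ℤₚ.pos-* 2 (toℕ j))))
    where shift : ∀ P K X → + 2 * P + + 2 + + 2 * K + X ≡ X + (+ 1 + (+ 1 + + 2 * P + + 2 * K))
          shift P K X = solve (P ∷ K ∷ X ∷ [])
  row≡column+offset D₂ₚ x =
    trans (shift P (+ α) (+ x)) (cong (_+_ (- (+ α * + x))) (sym (ℤₚ.pos-* 2 p)))
    where shift : ∀ P A X → + 2 * P - A * X ≡ - (A * X) + + 2 * P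
          shift P A X = solve (P ∷ A ∷ X ∷ [])
  row≡column+offset D₂ₚ₊α x =
    trans (shift P (+ α) (+ x)) (cong (λ u → + α * + x + (u + + α)) (sym (ℤₚ.pos-* 2 p)))
    where shift : ∀ P A X → + 2 * P + A + A * X ≡ A * X + (+ 2 * P + A)
          shift P A X = solve (P ∷ A ∷ X ∷ [])

  J-offset : ∀ j b → offset (pair (J j) b) ≡ 2 ℕ.* p ℕ.+ suc (toℕ b ℕ.+ 2 ℕ.* toℕ j)
  J-offset j b = swap (toℕ b) (2 ℕ.* p) (2 ℕ.* toℕ j)
    where
    swap : ∀ b m k → b ℕ.+ (suc m ℕ.+ k) ≡ m ℕ.+ suc (b ℕ.+ k)
    swap = ℕ-solve-∀

  rowPairSum : Block → ℤ
  rowPairSum (I _) = + 1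
  rowPairSum (J _) = - + 1

  row-pair-value : ∀ β x y → N ≡ + x + + y + + 1 → value (pair β 0F) x + value (pair β 1F) y ≡ rowPairSum β
  row-pair-value (I i) x y = identity G (FI i) (+ x) (+ y) N
    where
    identity : ∀ G F X Y N → N ≡ X + Y + + 1
             → ((G + + 2) * N + + 4 * F * N - + 2 * X) + (- (G * N) - + 4 * F * N - + 1 - + 2 * Y) ≡ + 1
    identity G F X Y _ refl = solve (G ∷ F ∷ X ∷ Y ∷ [])
  row-pair-value (J j) x y = identity P G (FJ j) (+ x) (+ y) N
    where
    identity : ∀ P G F X Y N → N ≡ X + Y + + 1
             → ((+ 4 * P + G - + 6) * N - + 4 * F * N + + 1 + + 2 * X) + (- ((+ 4 * P + G - + 4) * N) + + 4 * F * N + + 2 * Y) ≡ - + 1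
    identity P G F X Y _ refl = solve (P ∷ G ∷ F ∷ X ∷ Y ∷ [])

  column-pair-value : ∀ i x y → N ≡ + x + + y + + 1 → value (pair (I i) 0F) x + value (pair (I i) 1F) (suc y) ≡ - + 1
  column-pair-value i x y = identity G (FI i) (+ x) (+ y) N
    where
    identity : ∀ G F X Y N → N ≡ X + Y + + 1
             → ((G + + 2) * N + + 4 * F * N - + 2 * X) + (- (G * N) - + 4 * F * N - + 1 - + 2 * (+ 1 + Y)) ≡ - + 1
    identity G F X Y _ refl = solve (G ∷ F ∷ X ∷ Y ∷ [])

  D₂ₚ-value+P-bounds : ∀ {x S} → x < n → S ≡ value D₂ₚ x + P
    → (- ((+ 4 * P + G) * N) ℤ.< S) × (S ℤ.< - ((+ 4 * P + G - + 2) * N) + P - + 1)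
  D₂ₚ-value+P-bounds {x} {S} x<n S≡ = <-by (2 ℕ.* x ℕ.+ q) lower , <-by (2 ℕ.* y) upper
    where
    y : ℕ
    y = n ∸ suc x
    B : ℤ
    B = - ((+ 4 * P + G) * N)
    lower : S ≡ B + + suc (2 ℕ.* x ℕ.+ q)
    lower = trans S≡ (trans (regroup B (+ x) (+ q)) (cong (λ w → B + (+ 1 + (w + + q))) (sym (ℤₚ.pos-* 2 x))))
      where regroup : ∀ B X Q → B + + 2 * X + (+ 1 + Q) ≡ B + (+ 1 + (+ 2 * X + Q))
            regroup B X Q = solve (B ∷ X ∷ Q ∷ [])
    upper : - ((+ 4 * P + G - + 2) * N) + P - + 1 ≡ S + + suc (2 ℕ.* y)
    upper = trans (regroup P G (+ x) (+ y) N (n≡x+[n∸1+x]+1 x<n))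
                  (cong₂ (λ u w → u + (+ 1 + w)) (sym S≡) (sym (ℤₚ.pos-* 2 y)))
      where regroup : ∀ P G X Y N → N ≡ X + Y + + 1
                    → - ((+ 4 * P + G - + 2) * N) + P - + 1 ≡ (- ((+ 4 * P + G) * N) + + 2 * X + P) + (+ 1 + + 2 * Y)
            regroup P G X Y _ refl = solve (P ∷ G ∷ X ∷ Y ∷ [])

  D₂ₚ-value-P-bounds : ∀ {x S} → x < n → S ≡ value D₂ₚ x - P
    → (- ((+ 4 * P + G) * N) - P ℤ.≤ S) × (S ℤ.≤ - ((+ 4 * P + G - + 2) * N) - P - + 2)
  D₂ₚ-value-P-bounds {x} {S} x<n S≡ = ≤-by (2 ℕ.* x) lower , ≤-by (2 ℕ.* y) upper
    where
    y : ℕ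
    y = n ∸ suc x
    B : ℤ
    B = - ((+ 4 * P + G) * N)
    lower : S ≡ B - P + + (2 ℕ.* x)
    lower = trans S≡ (trans (regroup B (+ x) P) (cong (_+_ (B - P)) (sym (ℤₚ.pos-* 2 x))))
      where regroup : ∀ B X P → B + + 2 * X - P ≡ B - P + + 2 * X
            regroup B X P = solve (B ∷ X ∷ P ∷ [])
    upper : - ((+ 4 * P + G - + 2) * N) - P - + 2 ≡ S + + (2 ℕ.* y)
    upper = trans (regroup P G (+ x) (+ y) N (n≡x+[n∸1+x]+1 x<n))
                  (cong₂ _+_ (sym S≡) (sym (ℤₚ.pos-* 2 y)))
      where regroup : ∀ P G X Y N → N ≡ X + Y + + 1
                    → - ((+ 4 * P + G - + 2) * N) - P - + 2 ≡ (- ((+ 4 * P + G) * N) + + 2 * X - P) + + 2 * Y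
            regroup P G X Y _ refl = solve (P ∷ G ∷ X ∷ Y ∷ [])

  coefficient : Diagonal → ℤ
  coefficient (pair _ 0F) = - + 1
  coefficient (pair _ 1F) = + 1
  coefficient D₂ₚ         = - + α
  coefficient D₂ₚ₊α       = + α

  column≡coefficient* : ∀ φ x → column φ x ≡ coefficient φ * + x
  column≡coefficient* (pair _ 0F) x = sym (ℤₚ.-1*i≡-i (+ x))
  column≡coefficient* (pair _ 1F) x = sym (ℤₚ.*-identityˡ (+ x))
  column≡coefficient* D₂ₚ x         = ℤₚ.neg-distribˡ-* (+ α) (+ x)
  column≡coefficient* D₂ₚ₊α x       = refl

  module _ (α-lower : 2 ℕ.* p ∸ 1 ≤ α) (α-upper : α ≤ n ∸ 2 ℕ.* p ∸ 1) where

    -- 2 ℕ.* p ∸ 1 reduces to q ℕ.+ suc (q ℕ.+ 0).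
    2q<α : 2 ℕ.* q < α
    2q<α = subst (ℕ._≤ α) (ℕₚ.+-suc q (q ℕ.+ 0)) α-lower

    2p+α<n : 2 ℕ.* p ℕ.+ α < n
    2p+α<n = subst (ℕ._≤ n) (ℕₚ.+-comm α (suc (2 ℕ.* p))) α+1+2p≤n
      where
      α≤n∸[1+2p] : α ≤ n ∸ suc (2 ℕ.* p)
      α≤n∸[1+2p] = subst (α ≤_) (trans (ℕₚ.∸-+-assoc n (2 ℕ.* p) 1) (cong (n ∸_) (ℕₚ.+-comm (2 ℕ.* p) 1))) α-upper
      1+2p<n : suc (2 ℕ.* p) < n
      1+2p<n = ℕₚ.m∸n≢0⇒n<m (ℕₚ.>⇒≢ (ℕₚ.<-≤-trans (ℕₚ.m<n⇒0<n 2q<α) α≤n∸[1+2p]))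
      α+1+2p≤n : α ℕ.+ suc (2 ℕ.* p) ≤ n
      α+1+2p≤n = ℕₚ.≤-trans (ℕₚ.+-monoˡ-≤ (suc (2 ℕ.* p)) α≤n∸[1+2p])
                            (ℕₚ.≤-reflexive (ℕₚ.m∸n+n≡m (ℕₚ.<⇒≤ 1+2p<n)))

    instance
      n-nonZero : NonZero n
      n-nonZero = ℕ.>-nonZero (ℕₚ.m<n⇒0<n 2p+α<n)

    I<D₂ₚ : ∀ i b → offset (pair (I i) b) < offset D₂ₚ
    I<D₂ₚ i b = digit+double-< b (Finₚ.toℕ<n i)

    D₂ₚ<J : ∀ j b → offset D₂ₚ < offset (pair (J j) b)
    D₂ₚ<J j b = ℕₚ.≤-trans (ℕₚ.m≤m+n (suc (2 ℕ.* p)) (2 ℕ.* toℕ j)) (ℕₚ.m≤n+m _ (toℕ b))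

    J<D₂ₚ₊α : ∀ j b → offset (pair (J j) b) < offset D₂ₚ₊α
    J<D₂ₚ₊α j b = subst (ℕ._< offset D₂ₚ₊α) (sym (J-offset j b))
                        (ℕₚ.+-monoʳ-< (2 ℕ.* p) (ℕₚ.≤-<-trans (digit+double-< b (Finₚ.toℕ<n j)) 2q<α))

    D₂ₚ<D₂ₚ₊α : offset D₂ₚ < offset D₂ₚ₊α
    D₂ₚ<D₂ₚ₊α = ℕₚ.m<m+n (2 ℕ.* p) (ℕₚ.m<n⇒0<n 2q<α)

    pair<D₂ₚ₊α : ∀ β b → offset (pair β b) < offset D₂ₚ₊α
    pair<D₂ₚ₊α (I i) b = ℕₚ.<-trans (I<D₂ₚ i b) D₂ₚ<D₂ₚ₊α
    pair<D₂ₚ₊α (J j) b = J<D₂ₚ₊α j b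

    offset<n : ∀ φ → offset φ < n
    offset<n (pair β b)     = ℕₚ.<-trans (pair<D₂ₚ₊α β b) 2p+α<n
    offset<n D₂ₚ            = ℕₚ.<-trans D₂ₚ<D₂ₚ₊α 2p+α<n
    offset<n D₂ₚ₊α          = 2p+α<n

    offset-injective : ∀ {φ ψ} → offset φ ≡ offset ψ → φ ≡ ψ
    offset-injective {pair (I i) b} {pair (I i′) b′} eq with digit+double-injective b b′ eq
    ... | refl , eq′ = cong (λ i → pair (I i) b) (Finₚ.toℕ-injective eq′)
    offset-injective {pair (J j) b} {pair (J j′) b′} eq
      with digit+double-injective b b′
             (ℕₚ.suc-injective (ℕₚ.+-cancelˡ-≡ (2 ℕ.* p) _ _ (trans (sym (J-offset j b)) (trans eq (J-offset j′ b′)))))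
    ... | refl , eq′ = cong (λ j → pair (J j) b) (Finₚ.toℕ-injective eq′)
    offset-injective {pair (I i) b} {pair (J j) b′} eq = ⊥-elim (ℕₚ.<⇒≢ (ℕₚ.<-trans (I<D₂ₚ i b) (D₂ₚ<J j b′)) eq)
    offset-injective {pair (J j) b} {pair (I i) b′} eq = ⊥-elim (ℕₚ.>⇒≢ (ℕₚ.<-trans (I<D₂ₚ i b′) (D₂ₚ<J j b)) eq)
    offset-injective {pair (I i) b} {D₂ₚ} eq           = ⊥-elim (ℕₚ.<⇒≢ (I<D₂ₚ i b) eq)
    offset-injective {pair (J j) b} {D₂ₚ} eq           = ⊥-elim (ℕₚ.>⇒≢ (D₂ₚ<J j b) eq)
    offset-injective {pair β b} {D₂ₚ₊α} eq             = ⊥-elim (ℕₚ.<⇒≢ (pair<D₂ₚ₊α β b) eq)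
    offset-injective {D₂ₚ} {pair (I i) b} eq           = ⊥-elim (ℕₚ.>⇒≢ (I<D₂ₚ i b) eq)
    offset-injective {D₂ₚ} {pair (J j) b} eq           = ⊥-elim (ℕₚ.<⇒≢ (D₂ₚ<J j b) eq)
    offset-injective {D₂ₚ} {D₂ₚ} eq                    = refl
    offset-injective {D₂ₚ} {D₂ₚ₊α} eq                  = ⊥-elim (ℕₚ.<⇒≢ D₂ₚ<D₂ₚ₊α eq)
    offset-injective {D₂ₚ₊α} {pair β b} eq             = ⊥-elim (ℕₚ.>⇒≢ (pair<D₂ₚ₊α β b) eq)
    offset-injective {D₂ₚ₊α} {D₂ₚ} eq                  = ⊥-elim (ℕₚ.>⇒≢ D₂ₚ<D₂ₚ₊α eq)
    offset-injective {D₂ₚ₊α} {D₂ₚ₊α} eq                = refl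

    module _ (α-coprime : gcd α n ≡ 1) where

      coefficient-invertible : ∀ φ → ∃[ v ] coefficient φ * v ≡ + 1 mod N
      coefficient-invertible (pair _ 0F) = - + 1 , congruent (+ 0) refl
      coefficient-invertible (pair _ 1F) = + 1 , congruent (+ 0) refl
      coefficient-invertible D₂ₚ with gcd≡1⇒invertible {α} α-coprime
      ... | v , congruent k eq = - v , congruent k (trans (neg*neg (+ α) v) eq)
        where neg*neg : ∀ a v → - a * - v ≡ a * v
              neg*neg a v = solve (a ∷ v ∷ [])
      coefficient-invertible D₂ₚ₊α = gcd≡1⇒invertible {α} α-coprime

      column-surjective : ∀ φ c → ∃[ x ] x < n × column φ x ≡ c mod N
      column-surjective φ c =
        let v , uv≡1 = coefficient-invertible φ
            x , x<n , ux≡c = invertible⇒surjective (coefficient φ) uv≡1 c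
        in x , x<n , subst (_≡ c mod N) (sym (column≡coefficient* φ x)) ux≡c

      entry-on-diagonal : ∀ φ {r c} → r < n → c < n → + r ≡ + c + + offset φ mod N
                        → ∃[ x ] x < n × column φ x ≡ + c mod N × lookupCell entries r c ≡ value φ x
      -- lookupCell reads the first placement in cell (r, c); every placement there lies on φ.
      entry-on-diagonal φ {r} {c} r<n c<n on-diagonal =
        lookupCell-∈ entries (subst (_∈ entries) entry≡ (entry-∈ φ x₀<n)) at-cell
        where
        x₀ : ℕ
        x₀ = proj₁ (column-surjective φ (+ c))
        x₀<n : x₀ < n
        x₀<n = proj₁ (proj₂ (column-surjective φ (+ c)))
        column₀ : column φ x₀ ≡ + c mod N
        column₀ = proj₂ (proj₂ (column-surjective φ (+ c)))
        row₀ : row φ x₀ ≡ + r mod N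
        row₀ = subst (_≡ + r mod N) (sym (row≡column+offset φ x₀))
                     (≡-mod-trans (≡-mod-+ʳ (+ offset φ) column₀) (≡-mod-sym on-diagonal))
        entry≡ : entry φ x₀ ≡ (r , c , value φ x₀)
        entry≡ = cong₂ (λ r′ c′ → r′ , c′ , value φ x₀)
                       (≡-mod⇒modN≡ (row φ x₀) r<n row₀) (≡-mod⇒modN≡ (column φ x₀) c<n column₀)
        column-at : ∀ {ψ y w} → (r , c , w) ≡ entry ψ y → column ψ y ≡ + c mod N
        column-at eq = modN≡⇒≡-mod _ (sym (cong (proj₁ ∘ proj₂) eq))
        same-diagonal : ∀ {ψ y w} → (r , c , w) ≡ entry ψ y → ψ ≡ φ
        same-diagonal {ψ} {y} eq =
          offset-injective (≡-mod⇒≡ (offset<n ψ) (offset<n φ) (≡-mod-+-cancelˡ (column-at {ψ} {y} eq) row-at))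
          where
          row-at : column ψ y + + offset ψ ≡ + c + + offset φ mod N
          row-at = subst (_≡ + c + + offset φ mod N) (row≡column+offset ψ y)
                         (≡-mod-trans (modN≡⇒≡-mod _ (sym (cong proj₁ eq))) on-diagonal)
        at-cell : ∀ {w} → (r , c , w) ∈ entries → ∃[ x ] x < n × column φ x ≡ + c mod N × w ≡ value φ x
        at-cell w∈ with ∈-entries⁻ w∈
        ... | ψ , y , y<n , eq with same-diagonal {ψ} {y} eq
        ...   | refl = y , y<n , column-at {ψ} {y} eq , cong (proj₂ ∘ proj₂) eq

      row-entry : ∀ φ {a} → a < n → ∃[ x ] x < n × column φ x ≡ + a - + offset φ mod N × dRow n A a (offset φ) ≡ value φ x
      row-entry φ {a} a<n =
        let x , x<n , column≡c , d≡ = entry-on-diagonal φ a<n (modN-< (+ a - + t)) on-diagonal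
        in x , x<n , ≡-mod-trans column≡c (≡-mod-sym (≡-modN (+ a - + t))) , d≡
        where
        t : ℕ
        t = offset φ
        on-diagonal : + a ≡ + modN n (+ a - + t) + + t mod N
        on-diagonal = ≡-mod-trans (≡⇒≡-mod (sub-add (+ a) (+ t))) (≡-mod-+ʳ (+ t) (≡-modN (+ a - + t)))
          where sub-add : ∀ a t → a ≡ a - t + t
                sub-add a t = solve (a ∷ t ∷ [])

      column-entry : ∀ φ {a} → a < n → ∃[ x ] x < n × column φ x ≡ + a mod N × dCol n A a (offset φ) ≡ value φ x
      column-entry φ {a} a<n =
        entry-on-diagonal φ (modN-< (+ a + + offset φ)) a<n (≡-mod-sym (≡-modN (+ a + + offset φ)))

      row-pair : ∀ β {a} → a < n → dRow n A a (base β) + dRow n A a (suc (base β)) ≡ rowPairSum β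
      row-pair β {a} a<n =
        let x , x<n , column₀ , d₀ = row-entry (pair β 0F) a<n
            y , y<n , column₁ , d₁ = row-entry (pair β 1F) a<n
            y≡-x-1 = ≡-mod-trans column₁
                       (≡-mod-trans (≡⇒≡-mod (sub-suc (+ a) (+ base β))) (≡-mod-+ʳ (- + 1) (≡-mod-sym column₀)))
        in trans (cong₂ _+_ d₀ d₁) (row-pair-value β x y (y≡-x-1⇒n≡x+y+1 x<n y<n y≡-x-1))
        where
        sub-suc : ∀ a b → a - (+ 1 + b) ≡ a - b - + 1
        sub-suc a b = solve (a ∷ b ∷ [])

      column-pair : ∀ i {a} → a < n → a ≢ 0 → dCol n A a (base (I i)) + dCol n A a (suc (base (I i))) ≡ - + 1
      column-pair i {zero}  _   a≢0 = ⊥-elim (a≢0 refl)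
      column-pair i {suc a} a<n _   =
        let x , x<n , column₀ , d₀ = column-entry (pair (I i) 0F) a<n
            y , y<n , column₁ , d₁ = column-entry (pair (I i) 1F) a<n
            a≡-x-1 = ≡-mod-sym (≡-mod-trans (≡-mod-+ʳ (- + 1) column₀) (≡⇒≡-mod (suc-sub (+ a))))
        in trans (cong₂ _+_ d₀ (trans d₁ (cong (value (pair (I i) 1F)) (≡-mod⇒≡ y<n a<n column₁))))
                 (column-pair-value i x a (y≡-x-1⇒n≡x+y+1 x<n (ℕₚ.<-trans (ℕₚ.n<1+n a) a<n) a≡-x-1))
        where
        suc-sub : ∀ a → + 1 + a - + 1 ≡ a
        suc-sub a = solve (a ∷ [])

      row-sum-2p : ∀ {a} → a < n → ΣRow n A a (2 ℕ.* p) ≡ dRow n A a (2 ℕ.* p) + P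
      row-sum-2p {a} a<n = begin
        ΣRow n A a (2 ℕ.* p)           ≡⟨ sumℤ-upTo-suc d (2 ℕ.* p) ⟩
        S (2 ℕ.* p) + d (2 ℕ.* p)      ≡⟨ cong (_+ d (2 ℕ.* p)) (sumℤ-upTo-pairs d 0 p (+ 1) I-pairs) ⟩
        + 0 + P * + 1 + d (2 ℕ.* p)    ≡⟨ tidy P (d (2 ℕ.* p)) ⟩
        d (2 ℕ.* p) + P                ∎
        where
        d : ℕ → ℤ
        d = dRow n A a
        S : ℕ → ℤ
        S l = sumℤ (map d (upTo l))
        I-pairs : ∀ m → m < p → d (2 ℕ.* m) + d (suc (2 ℕ.* m)) ≡ + 1
        I-pairs = ∀Fin⇒∀< {P = λ m → d (2 ℕ.* m) + d (suc (2 ℕ.* m)) ≡ + 1} (λ i → row-pair (I i) a<n)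
        tidy : ∀ P D → + 0 + P * + 1 + D ≡ D + P
        tidy P D = solve (P ∷ D ∷ [])

      row-sum-4p-2 : ∀ {a} → a < n → ΣRow n A a (4 ℕ.* p ∸ 2) ≡ dRow n A a (2 ℕ.* p) + + 1
      row-sum-4p-2 {a} a<n = begin
        ΣRow n A a (4 ℕ.* p ∸ 2)               ≡⟨ cong S 1+[4p∸2]≡1+2p+2q ⟩
        S (suc (2 ℕ.* p) ℕ.+ 2 ℕ.* q)          ≡⟨ sumℤ-upTo-pairs d (suc (2 ℕ.* p)) q (- + 1) J-pairs ⟩
        ΣRow n A a (2 ℕ.* p) + + q * - + 1     ≡⟨ cong (_+ + q * - + 1) (row-sum-2p a<n) ⟩
        d (2 ℕ.* p) + (+ 1 + + q) + + q * - + 1 ≡⟨ tidy (d (2 ℕ.* p)) (+ q) ⟩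
        d (2 ℕ.* p) + + 1                      ∎
        where
        d : ℕ → ℤ
        d = dRow n A a
        S : ℕ → ℤ
        S l = sumℤ (map d (upTo l))
        J-pairs : ∀ m → m < q → d (suc (2 ℕ.* p) ℕ.+ 2 ℕ.* m) + d (suc (suc (2 ℕ.* p) ℕ.+ 2 ℕ.* m)) ≡ - + 1
        J-pairs = ∀Fin⇒∀< {P = λ m → d (suc (2 ℕ.* p) ℕ.+ 2 ℕ.* m) + d (suc (suc (2 ℕ.* p) ℕ.+ 2 ℕ.* m)) ≡ - + 1}
                          (λ j → row-pair (J j) a<n)
        1+[4p∸2]≡1+2p+2q : suc (4 ℕ.* p ∸ 2) ≡ suc (2 ℕ.* p) ℕ.+ 2 ℕ.* q
        1+[4p∸2]≡1+2p+2q = cong suc (trans (cong (_∸ 2) (split q)) (ℕₚ.m+n∸m≡n 2 _))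
          where split : ∀ q → 4 ℕ.* suc q ≡ 2 ℕ.+ (2 ℕ.* suc q ℕ.+ 2 ℕ.* q)
                split = ℕ-solve-∀
        tidy : ∀ D Q → D + (+ 1 + Q) + Q * - + 1 ≡ D + + 1
        tidy D Q = solve (D ∷ Q ∷ [])

      column-sum-2p : ∀ {a} → a < n → a ≢ 0 → ΣCol n A a (2 ℕ.* p) ≡ dCol n A a (2 ℕ.* p) - P
      column-sum-2p {a} a<n a≢0 = begin
        ΣCol n A a (2 ℕ.* p)           ≡⟨ sumℤ-upTo-suc d (2 ℕ.* p) ⟩
        S (2 ℕ.* p) + d (2 ℕ.* p)      ≡⟨ cong (_+ d (2 ℕ.* p)) (sumℤ-upTo-pairs d 0 p (- + 1) I-pairs) ⟩
        + 0 + P * - + 1 + d (2 ℕ.* p)  ≡⟨ tidy P (d (2 ℕ.* p)) ⟩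
        d (2 ℕ.* p) - P                ∎
        where
        d : ℕ → ℤ
        d = dCol n A a
        S : ℕ → ℤ
        S l = sumℤ (map d (upTo l))
        I-pairs : ∀ m → m < p → d (2 ℕ.* m) + d (suc (2 ℕ.* m)) ≡ - + 1
        I-pairs = ∀Fin⇒∀< {P = λ m → d (2 ℕ.* m) + d (suc (2 ℕ.* m)) ≡ - + 1} (λ i → column-pair i a<n a≢0)
        tidy : ∀ P D → + 0 + P * - + 1 + D ≡ D - P
        tidy P D = solve (P ∷ D ∷ [])

      row-properties : ∀ a → a < n
        → (- ((+ 4 * P + G) * N) ℤ.< ΣRow n A a (2 ℕ.* p))
        × (ΣRow n A a (2 ℕ.* p) ≡ dRow n A a (2 ℕ.* p) + P)
        × (ΣRow n A a (2 ℕ.* p) ℤ.< - ((+ 4 * P + G - + 2) * N) + P - + 1)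
        × (ΣRow n A a (4 ℕ.* p ∸ 2) ≡ dRow n A a (2 ℕ.* p) + + 1)
      row-properties a a<n = proj₁ bounds , row-sum-2p a<n , proj₂ bounds , row-sum-4p-2 a<n
        where
        bounds = let x , x<n , _ , d≡ = row-entry D₂ₚ a<n
                 in D₂ₚ-value+P-bounds x<n (trans (row-sum-2p a<n) (cong (_+ P) d≡))

      column-properties : ∀ a → a < n → a ≢ 0
        → (- ((+ 4 * P + G) * N) - P ℤ.≤ ΣCol n A a (2 ℕ.* p))
        × (ΣCol n A a (2 ℕ.* p) ≡ dCol n A a (2 ℕ.* p) - P)
        × (ΣCol n A a (2 ℕ.* p) ℤ.≤ - ((+ 4 * P + G - + 2) * N) - P - + 2)
      column-properties a a<n a≢0 = proj₁ bounds , column-sum-2p a<n a≢0 , proj₂ bounds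
        where
        bounds = let x , x<n , _ , d≡ = column-entry D₂ₚ a<n
                 in D₂ₚ-value-P-bounds x<n (trans (column-sum-2p a<n a≢0) (cong (_- P) d≡))

mainTheorem13 : (p γ n α : ℕ) → 0 < p → 0 < γ → 4 ℕ.* p ≤ n
  → 2 ℕ.* p ∸ 1 ≤ α → α ≤ n ∸ 2 ℕ.* p ∸ 1 → gcd α n ≡ 1
  → (fI : Permutation′ p) → (fJ : Permutation′ (p ∸ 1))
  → let M = A′ p γ n α fI fJ
        N = + n
        P = + p
        G = + γ
    in (∀ a → a < n →
          (- ((+ 4 * P + G) * N) ℤ.< ΣRow n M a (2 ℕ.* p))
        × (ΣRow n M a (2 ℕ.* p) ≡ dRow n M a (2 ℕ.* p) + P)
        × (ΣRow n M a (2 ℕ.* p) ℤ.< - ((+ 4 * P + G - + 2) * N) + P - + 1)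
        × (ΣRow n M a (4 ℕ.* p ∸ 2) ≡ dRow n M a (2 ℕ.* p) + + 1))
     × (∀ a → a < n → a ≢ 0 →
          (- ((+ 4 * P + G) * N) - P ℤ.≤ ΣCol n M a (2 ℕ.* p))
        × (ΣCol n M a (2 ℕ.* p) ≡ dCol n M a (2 ℕ.* p) - P)
        × (ΣCol n M a (2 ℕ.* p) ℤ.≤ - ((+ 4 * P + G - + 2) * N) - P - + 2))
mainTheorem13 zero    γ n α () _ _ _ _ _ _ _
mainTheorem13 (suc q) γ n α _ _ _ α-lower α-upper α-coprime fI fJ =
  row-properties α-lower α-upper α-coprime , column-properties α-lower α-upper α-coprime
  where open Array q γ n α fI fJ
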